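{- Let $\Gamma\subseteq\mathcal{L}_0({\sf par})$, let $A\in\mathcal{L}_0$, let $\theta$ be an $A$-projective substitution and $A^\dagger\in\Gamma$ with $\vdash\theta(A)\leftrightarrow A^\dagger$. Then for every formula $B$: $\vdash A\to B$ if and only if $\vdash\theta(A^\dagger\to B)$.
   Context: $\mathcal{L}_0$ is the propositional language with $\wedge,\vee,\to,\bot$ over a finite set of atoms ${\sf atom}={\sf var}\cup{\sf par}$ (disjoint variables and parameters); $\mathcal{L}_0({\sf par})$ is the set of formulas whose atoms are all parameters. $\vdash$ is ${\sf IPC}$-derivability. A substitution commutes with the connectives, fixes $\bot$ and fixes every parameter. $\theta$ is $A$-projective if $A\vdash a\leftrightarrow\theta(a)$ for every atom $a$. -}

module Defs where

open import Data.Nat using (ℕ)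
open import Data.Fin using (Fin)
open import Data.List using (List; []; _∷_)
open import Data.List.Membership.Propositional using (_∈_)
open import Data.Product using (_×_)
open import Data.Unit using (⊤)
open import Data.Empty using (⊥)

data Fm (nv np : ℕ) : Set where
  var  : Fin nv → Fm nv np
  par  : Fin np → Fm nv np
  ⊥'   : Fm nv np
  _∧'_ : Fm nv np → Fm nv np → Fm nv np
  _∨'_ : Fm nv np → Fm nv np → Fm nv np
  _⇒_  : Fm nv np → Fm nv np → Fm nv np

infixr 6 _∧'_
infixr 5 _∨'_
infixr 4 _⇒_

module _ {nv np : ℕ} where

  infixr 3 _⇔'_
  _⇔'_ : Fm nv np → Fm nv np → Fm nv np
  A ⇔' B = (A ⇒ B) ∧' (B ⇒ A)

  -- F ∈ L₀(par): every atom of F is a parameter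
  ParOnly : Fm nv np → Set
  ParOnly (var _) = ⊥
  ParOnly (par _) = ⊤
  ParOnly ⊥' = ⊤
  ParOnly (A ∧' B) = ParOnly A × ParOnly B
  ParOnly (A ∨' B) = ParOnly A × ParOnly B
  ParOnly (A ⇒ B) = ParOnly A × ParOnly B

  -- Substitutions: determined by the images of the variables; parameters and ⊥ fixed.
  Subst : Set
  Subst = Fin nv → Fm nv np

  sub : Subst → Fm nv np → Fm nv np
  sub θ (var x) = θ x
  sub θ (par p) = par p
  sub θ ⊥' = ⊥'
  sub θ (A ∧' B) = sub θ A ∧' sub θ B
  sub θ (A ∨' B) = sub θ A ∨' sub θ B
  sub θ (A ⇒ B) = sub θ A ⇒ sub θ B

  -- IPC derivability (natural deduction, finite list of assumptions)
  infix 2 _⊢_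
  data _⊢_ (Δ : List (Fm nv np)) : Fm nv np → Set where
    hyp  : ∀ {A} → A ∈ Δ → Δ ⊢ A
    ∧I   : ∀ {A B} → Δ ⊢ A → Δ ⊢ B → Δ ⊢ A ∧' B
    ∧E₁  : ∀ {A B} → Δ ⊢ A ∧' B → Δ ⊢ A
    ∧E₂  : ∀ {A B} → Δ ⊢ A ∧' B → Δ ⊢ B
    ∨I₁  : ∀ {A B} → Δ ⊢ A → Δ ⊢ A ∨' B
    ∨I₂  : ∀ {A B} → Δ ⊢ B → Δ ⊢ A ∨' B
    ∨E   : ∀ {A B C} → Δ ⊢ A ∨' B → (A ∷ Δ) ⊢ C → (B ∷ Δ) ⊢ C → Δ ⊢ C
    ⇒I   : ∀ {A B} → (A ∷ Δ) ⊢ B → Δ ⊢ A ⇒ B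
    ⇒E   : ∀ {A B} → Δ ⊢ A ⇒ B → Δ ⊢ A → Δ ⊢ B
    ⊥E   : ∀ {A} → Δ ⊢ ⊥' → Δ ⊢ A

  Projective : Fm nv np → Subst → Set
  Projective A θ =
    (∀ x → (A ∷ []) ⊢ var x ⇔' sub θ (var x)) ×
    (∀ p → (A ∷ []) ⊢ par p ⇔' sub θ (par p))

{-# OPTIONS --safe #-}
module Submission where

open import Defs
open import Data.Nat using (ℕ)
open import Data.List using (List; []; _∷_; map)
open import Data.List.Membership.Propositional.Properties using (∈-map⁺)
open import Data.List.Relation.Binary.Subset.Propositional using (_⊆_)
open import Data.List.Relation.Binary.Subset.Propositional.Properties using (∷⁺ʳ; xs⊆x∷xs)
open import Data.List.Relation.Unary.Any using (here)
open import Data.Product using (_,_)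
open import Function.Bundles using (_⇔_; mk⇔)
open import Relation.Binary.PropositionalEquality using (_≡_; refl; sym; cong₂; subst)

-- (⇒) substitution instances of theorems are theorems, so ⊢ θA → θB,
-- and ⊢ A† → θA; since A† has only parameters, θ(A†) = A†.
-- (⇐) Under the assumption A, A-projectivity makes every formula C equivalent
-- to θ(C); chaining A → θA → A† → θB → B gives A ⊢ B.

module _ {nv np : ℕ} where

  private variable
    Δ Δ' : List (Fm nv np)
    C D P P' Q Q' R : Fm nv np

  ⊢-mono : Δ ⊆ Δ' → Δ ⊢ C → Δ' ⊢ C
  ⊢-mono ρ (hyp x)    = hyp (ρ x)
  ⊢-mono ρ (∧I d e)   = ∧I (⊢-mono ρ d) (⊢-mono ρ e)
  ⊢-mono ρ (∧E₁ d)    = ∧E₁ (⊢-mono ρ d)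
  ⊢-mono ρ (∧E₂ d)    = ∧E₂ (⊢-mono ρ d)
  ⊢-mono ρ (∨I₁ d)    = ∨I₁ (⊢-mono ρ d)
  ⊢-mono ρ (∨I₂ d)    = ∨I₂ (⊢-mono ρ d)
  ⊢-mono ρ (∨E d e f) = ∨E (⊢-mono ρ d) (⊢-mono (∷⁺ʳ _ ρ) e) (⊢-mono (∷⁺ʳ _ ρ) f)
  ⊢-mono ρ (⇒I d)     = ⇒I (⊢-mono (∷⁺ʳ _ ρ) d)
  ⊢-mono ρ (⇒E d e)   = ⇒E (⊢-mono ρ d) (⊢-mono ρ e)
  ⊢-mono ρ (⊥E d)     = ⊥E (⊢-mono ρ d)

  ⊢-weaken : Δ ⊢ C → D ∷ Δ ⊢ C
  ⊢-weaken = ⊢-mono (xs⊆x∷xs _ _)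

  ⊢-sub : (θ : Subst) → Δ ⊢ C → map (sub θ) Δ ⊢ sub θ C
  ⊢-sub θ (hyp x)    = hyp (∈-map⁺ (sub θ) x)
  ⊢-sub θ (∧I d e)   = ∧I (⊢-sub θ d) (⊢-sub θ e)
  ⊢-sub θ (∧E₁ d)    = ∧E₁ (⊢-sub θ d)
  ⊢-sub θ (∧E₂ d)    = ∧E₂ (⊢-sub θ d)
  ⊢-sub θ (∨I₁ d)    = ∨I₁ (⊢-sub θ d)
  ⊢-sub θ (∨I₂ d)    = ∨I₂ (⊢-sub θ d)
  ⊢-sub θ (∨E d e f) = ∨E (⊢-sub θ d) (⊢-sub θ e) (⊢-sub θ f)
  ⊢-sub θ (⇒I d)     = ⇒I (⊢-sub θ d)
  ⊢-sub θ (⇒E d e)   = ⇒E (⊢-sub θ d) (⊢-sub θ e)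
  ⊢-sub θ (⊥E d)     = ⊥E (⊢-sub θ d)

  sub-ParOnly : ∀ θ (C : Fm nv np) → ParOnly C → sub θ C ≡ C
  sub-ParOnly θ (par p)  _       = refl
  sub-ParOnly θ ⊥'       _       = refl
  sub-ParOnly θ (C ∧' D) (c , d) = cong₂ _∧'_ (sub-ParOnly θ C c) (sub-ParOnly θ D d)
  sub-ParOnly θ (C ∨' D) (c , d) = cong₂ _∨'_ (sub-ParOnly θ C c) (sub-ParOnly θ D d)
  sub-ParOnly θ (C ⇒ D)  (c , d) = cong₂ _⇒_ (sub-ParOnly θ C c) (sub-ParOnly θ D d)

  assumption : C ∷ Δ ⊢ C
  assumption = hyp (here refl)

  ⇒-refl : Δ ⊢ P ⇒ P
  ⇒-refl = ⇒I assumption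

  ⇒-trans : Δ ⊢ P ⇒ Q → Δ ⊢ Q ⇒ R → Δ ⊢ P ⇒ R
  ⇒-trans f g = ⇒I (⇒E (⊢-weaken g) (⇒E (⊢-weaken f) assumption))

  ∧'-mono : Δ ⊢ P ⇒ P' → Δ ⊢ Q ⇒ Q' → Δ ⊢ P ∧' Q ⇒ P' ∧' Q'
  ∧'-mono f g = ⇒I (∧I (⇒E (⊢-weaken f) (∧E₁ assumption)) (⇒E (⊢-weaken g) (∧E₂ assumption)))

  ∨'-mono : Δ ⊢ P ⇒ P' → Δ ⊢ Q ⇒ Q' → Δ ⊢ P ∨' Q ⇒ P' ∨' Q'
  ∨'-mono f g = ⇒I (∨E assumption (∨I₁ (⇒E (⊢-weaken (⊢-weaken f)) assumption))
                                  (∨I₂ (⇒E (⊢-weaken (⊢-weaken g)) assumption)))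

  ⇒-mono : Δ ⊢ P' ⇒ P → Δ ⊢ Q ⇒ Q' → Δ ⊢ (P ⇒ Q) ⇒ (P' ⇒ Q')
  ⇒-mono f g = ⇒I (⇒-trans (⊢-weaken f) (⇒-trans assumption (⊢-weaken g)))

  projective⇒⊢⇔'sub : ∀ {A : Fm nv np} {θ} → Projective A θ → ∀ C → A ∷ [] ⊢ C ⇔' sub θ C
  projective⇒⊢⇔'sub (onVar , _) (var x) = onVar x
  projective⇒⊢⇔'sub (_ , onPar) (par p) = onPar p
  projective⇒⊢⇔'sub pr ⊥'          = ∧I ⇒-refl ⇒-refl
  projective⇒⊢⇔'sub pr (C ∧' D) with projective⇒⊢⇔'sub pr C | projective⇒⊢⇔'sub pr D
  ... | c | d = ∧I (∧'-mono (∧E₁ c) (∧E₁ d)) (∧'-mono (∧E₂ c) (∧E₂ d))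
  projective⇒⊢⇔'sub pr (C ∨' D) with projective⇒⊢⇔'sub pr C | projective⇒⊢⇔'sub pr D
  ... | c | d = ∧I (∨'-mono (∧E₁ c) (∧E₁ d)) (∨'-mono (∧E₂ c) (∧E₂ d))
  projective⇒⊢⇔'sub pr (C ⇒ D) with projective⇒⊢⇔'sub pr C | projective⇒⊢⇔'sub pr D
  ... | c | d = ∧I (⇒-mono (∧E₂ c) (∧E₁ d)) (⇒-mono (∧E₁ c) (∧E₂ d))

lemma3p2 : (nv np : ℕ) (Γ : Fm nv np → Set) → (∀ F → Γ F → ParOnly F) →
    (A : Fm nv np) (θ : Subst) → Projective A θ →
    (A† : Fm nv np) → Γ A† → [] ⊢ sub θ A ⇔' A† →
    (B : Fm nv np) → ([] ⊢ A ⇒ B) ⇔ ([] ⊢ sub θ (A† ⇒ B))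
lemma3p2 nv np Γ Γ⊆ParOnly A θ proj A† A†∈Γ θA⇔A† B = mk⇔ to from
  where
  θA†≡A† : sub θ A† ≡ A†
  θA†≡A† = sub-ParOnly θ A† (Γ⊆ParOnly A† A†∈Γ)

  to : [] ⊢ A ⇒ B → [] ⊢ sub θ A† ⇒ sub θ B
  to ⊢A⇒B = subst (λ X → [] ⊢ X ⇒ sub θ B) (sym θA†≡A†)
                  (⇒-trans (∧E₂ θA⇔A†) (⊢-sub θ ⊢A⇒B))

  from : [] ⊢ sub θ A† ⇒ sub θ B → [] ⊢ A ⇒ B
  from ⊢θA†⇒θB = ⇒I (⇒E (⇒-trans A⇒θA (⇒-trans θA⇒A† (⇒-trans A†⇒θB θB⇒B))) assumption)
    where
    A⇒θA : A ∷ [] ⊢ A ⇒ sub θ A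
    A⇒θA = ∧E₁ (projective⇒⊢⇔'sub proj A)
    θA⇒A† : A ∷ [] ⊢ sub θ A ⇒ A†
    θA⇒A† = ⊢-weaken (∧E₁ θA⇔A†)
    A†⇒θB : A ∷ [] ⊢ A† ⇒ sub θ B
    A†⇒θB = ⊢-weaken (subst (λ X → [] ⊢ X ⇒ sub θ B) θA†≡A† ⊢θA†⇒θB)
    θB⇒B : A ∷ [] ⊢ sub θ B ⇒ B
    θB⇒B = ∧E₂ (projective⇒⊢⇔'sub proj B)
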